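{- Let $n=2^\ell$, $d$ a positive integer, $m=d\ell$, and $\varepsilon=2^{ -r}$ with $r$ an integer, $1\le r\le m$. Then the function $\widetilde{2\mathrm{val}}:[n]^d\to\mathbb{N}$ is monotone, and for every $j\in\{1,\dots,m'\}$ and $k\in\{1,\dots,\frac1{2\varepsilon}\}$ the function $\widetilde{g_{j,k}}$ is $\varepsilon/2$-far from monotone.
   Context: Identify $[n]=\{0,1,\dots,n-1\}$, with each $z\in[n]$ written as an $\ell$-bit vector $(z_1,\dots,z_\ell)$, $z_1$ least significant. Define $\phi:[n]^d\to\{0,1\}^{d\ell}$ by concatenating the binary representations of $y_1,\dots,y_d$ in order (bits of $y_1$ in positions $1,\dots,\ell$, of $y_2$ in positions $\ell+1,\dots,2\ell$, etc.). For $f:\{0,1\}^{d\ell}\to\mathbb{Z}$ let $\widetilde f=f\circ\phi$. For $x\in\{0,1\}^m$ let $\mathrm{val}(x)=\sum_{i=1}^m 2^{i-1}x_i$. Let $m'=m+1-\log_2(1/\varepsilon)$. For $k\in\{1,\dots,\frac{1}{2\varepsilon}\}$ let $S_k=\{x: 2(k-1)\varepsilon 2^m\le \mathrm{val}(x)\le 2k\varepsilon2^m-1\}$, and for $j\in\{1,\dots,m'\}$ let $g_{j,k}(x)=2\mathrm{val}(x)-2^j-1$ if $x_j=1$ and $x\in S_k$, and $g_{j,k}(x)=2\mathrm{val}(x)$ otherwise. $[n]^d$ has the coordinate-wise partial order; a function $h$ on $[n]^d$ is monotone if $h(u)\le h(v)$ whenever $u\preceq v$, and is $\delta$-far from monotone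 if at least a $\delta$ fraction of its values must be changed to make it monotone. -}

module Defs where

open import Data.Bool using (Bool; true; false; if_then_else_)
open import Data.Nat as ℕ using (ℕ; zero; suc; _^_; _∸_)
open import Data.Nat.DivMod using (_/_; _%_)
open import Data.Nat.Properties using (m^n≢0)
open import Data.Fin using (Fin; toℕ)
open import Data.Vec using (Vec; []; _∷_; lookup; concat; map)
open import Data.List as List using (List; length; filter; allFin; concatMap)
open import Data.Integer as ℤ using (ℤ; +_)
import Data.Integer.Properties as ℤP
open import Data.Rational as ℚ using (ℚ)
import Data.Rational.Properties as ℚP
import Relation.Nullary
open import Relation.Nullary using (¬_; ¬?; yes; no; _×-dec_)
open import Relation.Binary.PropositionalEquality using (_≡_)

-- ℓ-bit binary representation of z, least significant bit first
-- (position 1 of the paper = head of the vector).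
toBits : (ℓ : ℕ) → ℕ → Vec Bool ℓ
toBits zero    z = []
toBits (suc ℓ) z = (z % 2 ℕ.≡ᵇ 1) ∷ toBits ℓ (z / 2)

φ : (ℓ d : ℕ) → Vec (Fin (2 ^ ℓ)) d → Vec Bool (d ℕ.* ℓ)
φ ℓ d y = concat (map (λ z → toBits ℓ (toℕ z)) y)

lift : (ℓ d : ℕ) → (Vec Bool (d ℕ.* ℓ) → ℤ) → Vec (Fin (2 ^ ℓ)) d → ℤ
lift ℓ d f y = f (φ ℓ d y)

bitℕ : Bool → ℕ
bitℕ true  = 1
bitℕ false = 0

val : ∀ {m} → Vec Bool m → ℕ
val []      = 0
val (b ∷ x) = bitℕ b ℕ.+ 2 ℕ.* val x

-- x_j, 1-based (j = 0 or j > m gives false; only used for 1 ≤ j ≤ m)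
bit : ∀ {m} → Vec Bool m → ℕ → Bool
bit []      _             = false
bit (b ∷ x) zero          = false
bit (b ∷ x) (suc zero)    = b
bit (b ∷ x) (suc (suc j)) = bit x (suc j)

twoVal : ∀ {m} → Vec Bool m → ℤ
twoVal x = + (2 ℕ.* val x)

ofℕ : ℕ → ℚ
ofℕ n = (+ n) ℚ./ 1

eps : ℕ → ℚ
eps r = (+ 1) ℚ./ (2 ^ r)
  where instance _ = m^n≢0 2 r

inS : ∀ {m} → ℚ → ℕ → Vec Bool m → Set
inS {m} ε k x =
  (ofℕ 2 ℚ.* (ofℕ k ℚ.- ofℕ 1) ℚ.* ε ℚ.* ofℕ (2 ^ m) ℚ.≤ ofℕ (val x))
  Data.Product.× (ofℕ (val x) ℚ.≤ ofℕ 2 ℚ.* ofℕ k ℚ.* ε ℚ.* ofℕ (2 ^ m) ℚ.- ofℕ 1)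
  where import Data.Product

inS? : ∀ {m} (ε : ℚ) (k : ℕ) (x : Vec Bool m) → Relation.Nullary.Dec (inS ε k x)
inS? ε k x = (_ ℚP.≤? _) ×-dec (_ ℚP.≤? _)

g : ∀ {m} → ℚ → (j k : ℕ) → Vec Bool m → ℤ
g ε j k x with bit x j | inS? ε k x
... | true  | yes _ = + (2 ℕ.* val x) ℤ.- + (2 ^ j) ℤ.- + 1
... | true  | no  _ = + (2 ℕ.* val x)
... | false | _     = + (2 ℕ.* val x)

_⪯_ : ∀ {n d} → Vec (Fin n) d → Vec (Fin n) d → Set
_⪯_ {n} {d} u v = (i : Fin d) → toℕ (lookup u i) ℕ.≤ toℕ (lookup v i)

Monotone : ∀ {n d} → (Vec (Fin n) d → ℤ) → Set
Monotone {n} {d} h = ∀ (u v : Vec (Fin n) d) → u ⪯ v → h u ℤ.≤ h v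

points : (n d : ℕ) → List (Vec (Fin n) d)
points n zero    = [] List.∷ List.[]
points n (suc d) = concatMap (λ i → List.map (i ∷_) (points n d)) (allFin n)

distance : ∀ {n d} → (Vec (Fin n) d → ℤ) → (Vec (Fin n) d → ℤ) → ℕ
distance {n} {d} h h' = length (filter (λ u → ¬? (h u ℤP.≟ h' u)) (points n d))

FarFromMonotone : ∀ {n d} → ℚ → (Vec (Fin n) d → ℤ) → Set
FarFromMonotone {n} {d} δ h =
  ∀ (h' : Vec (Fin n) d → ℤ) → Monotone h' →
  δ ℚ.* ofℕ (n ^ d) ℚ.≤ ofℕ (distance h h')

-- 2·val ∘ φ is monotone because φ maps the coordinatewise order of [n]^d into the bitwise
-- order of {0,1}^m, on which val is monotone.  For g = g_{j,k}, take the points x with x_j = 0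
-- whose top r − 1 bits spell k − 1, and pair each with x + 2^{j−1}.  Both lie in
-- S_k = [(k−1)·2^{m−r+1}, k·2^{m−r+1}), the pair is ordered bitwise, and g drops from 2x at x to
-- 2x − 1 at x + 2^{j−1}.  These ε2^m pairs are disjoint, and a monotone function must differ from
-- g at a point of every violated pair; φ is a bijection, so all of this transfers to [n]^d.
module Submission where

open import Defs
open import Data.Bool as Bool using (Bool; true; false; f≤t; b≤b)
open import Data.Nat
open import Data.Nat.Properties
open import Data.Nat.DivMod
open import Data.Nat.Divisibility using (m∣m*n)
import Data.Nat.Solver as ℕ-Solver
open import Data.Integer as ℤ using (+_; +≤+)
import Data.Integer.Properties as ℤP
import Data.Integer.Solver as ℤ-Solver
open import Data.Rational as ℚ using (ℚ; 1ℚ; toℚᵘ)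
import Data.Rational.Properties as ℚP
open import Data.Rational.Solver using (module +-*-Solver)
open import Data.Rational.Unnormalised as ℚᵘ using (mkℚᵘ; *≡*; *≤*)
import Data.Rational.Unnormalised.Properties as ℚᵘP
open import Data.Fin using (Fin; zero; suc; toℕ; fromℕ<)
open import Data.Fin.Properties using (toℕ<n; toℕ-fromℕ<; toℕ-injective; pigeonhole) renaming (<⇒≢ to <⇒≢ᶠ)
open import Data.Vec using (Vec; []; _∷_; _++_; map; concat; group; take; drop)
open import Data.Vec.Properties using (map-∘; map-cong; map-id; take++drop≡id; ++-injectiveˡ; ++-injectiveʳ; ∷-injectiveʳ)
open import Data.Vec.Relation.Binary.Pointwise.Inductive as Pointwise using (Pointwise; []; _∷_)
open import Data.List as List using (List; length; filter)
open import Data.List.Relation.Unary.Any as Any using (here)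
open import Data.List.Relation.Unary.Any.Properties using (lookup-index)
open import Data.List.Membership.Propositional using (_∈_; lose)
open import Data.List.Membership.Propositional.Properties using (∈-filter⁺; ∈-allFin; ∈-map⁺; ∈-concatMap⁺)
open import Data.Product using (_×_; _,_; proj₁; proj₂)
open import Function.Definitions using (Injective)
open import Relation.Unary using (Decidable)
open import Relation.Nullary using (¬_; ¬?; yes; no; does; contradiction)
open import Relation.Binary.PropositionalEquality

bitℕ<2 : ∀ b → bitℕ b < 2
bitℕ<2 false = s≤s z≤n
bitℕ<2 true  = s≤s (s≤s z≤n)

bitℕ-% : ∀ b y → (bitℕ b + 2 * y) % 2 ≡ bitℕ b
bitℕ-% b y = begin
  (bitℕ b + 2 * y) % 2 ≡⟨ cong (λ z → (bitℕ b + z) % 2) (*-comm 2 y) ⟩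
  (bitℕ b + y * 2) % 2 ≡⟨ [m+kn]%n≡m%n (bitℕ b) y 2 ⟩
  bitℕ b % 2           ≡⟨ m<n⇒m%n≡m (bitℕ<2 b) ⟩
  bitℕ b               ∎
  where open ≡-Reasoning

bitℕ-/ : ∀ b y → (bitℕ b + 2 * y) / 2 ≡ y
bitℕ-/ b y = begin
  (bitℕ b + 2 * y) / 2     ≡⟨ +-distrib-/-∣ʳ (bitℕ b) (m∣m*n y) ⟩
  bitℕ b / 2 + 2 * y / 2   ≡⟨ cong₂ _+_ (m<n⇒m/n≡0 (bitℕ<2 b)) (cong (_/ 2) (*-comm 2 y)) ⟩
  y * 2 / 2                ≡⟨ m*n/n≡m y 2 ⟩
  y                        ∎
  where open ≡-Reasoning

toBits-cons : ∀ ℓ b y → toBits (suc ℓ) (bitℕ b + 2 * y) ≡ b ∷ toBits ℓ y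
toBits-cons ℓ b y rewrite bitℕ-% b y | bitℕ-/ b y with b
... | false = refl
... | true  = refl

toBits-val : ∀ {ℓ} (x : Vec Bool ℓ) → toBits ℓ (val x) ≡ x
toBits-val []      = refl
toBits-val (b ∷ x) = trans (toBits-cons _ b (val x)) (cong (b ∷_) (toBits-val x))

val<2^ : ∀ {ℓ} (x : Vec Bool ℓ) → val x < 2 ^ ℓ
val<2^ []              = s≤s z≤n
val<2^ {suc ℓ} (b ∷ x) = begin-strict
  bitℕ b + 2 * val x   <⟨ +-monoˡ-< (2 * val x) (bitℕ<2 b) ⟩
  2 + 2 * val x        ≡⟨ *-distribˡ-+ 2 1 (val x) ⟨
  2 * suc (val x)      ≤⟨ *-monoʳ-≤ 2 (val<2^ x) ⟩
  2 * 2 ^ ℓ            ∎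
  where open ≤-Reasoning

val-toBits : ∀ ℓ {z} → z < 2 ^ ℓ → val (toBits ℓ z) ≡ z
val-toBits zero    {zero}  _          = refl
val-toBits zero    {suc _} (s≤s ())
val-toBits (suc ℓ) {z}    z<2^ℓ = begin
  bitℕ (z % 2 ≡ᵇ 1) + 2 * val (toBits ℓ (z / 2)) ≡⟨ cong₂ _+_ lowBit (cong (2 *_) (val-toBits ℓ quotient<)) ⟩
  z % 2 + 2 * (z / 2)                             ≡⟨ cong (λ v → z % 2 + v) (*-comm 2 (z / 2)) ⟩
  z % 2 + z / 2 * 2                               ≡⟨ m≡m%n+[m/n]*n z 2 ⟨
  z                                               ∎
  where
  open ≡-Reasoning
  quotient< : z / 2 < 2 ^ ℓ
  quotient< = m<n*o⇒m/o<n (subst (z <_) (*-comm 2 (2 ^ ℓ)) z<2^ℓ)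
  lowBit : bitℕ (z % 2 ≡ᵇ 1) ≡ z % 2
  lowBit with z % 2 | m%n<n z 2
  ... | 0 | _ = refl
  ... | 1 | _ = refl
  ... | suc (suc _) | s≤s (s≤s ())

toBits-injective : ∀ {ℓ} (a a′ : Fin (2 ^ ℓ)) → toBits ℓ (toℕ a) ≡ toBits ℓ (toℕ a′) → a ≡ a′
toBits-injective {ℓ} a a′ eq = toℕ-injective (begin
  toℕ a                    ≡⟨ val-toBits ℓ (toℕ<n a) ⟨
  val (toBits ℓ (toℕ a))   ≡⟨ cong val eq ⟩
  val (toBits ℓ (toℕ a′))  ≡⟨ val-toBits ℓ (toℕ<n a′) ⟩
  toℕ a′                   ∎)
  where open ≡-Reasoning

val-++ : ∀ {p q} (x : Vec Bool p) (y : Vec Bool q) → val (x ++ y) ≡ val x + 2 ^ p * val y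
val-++ []              y = sym (+-identityʳ _)
val-++ {suc p} (b ∷ x) y = begin
  bitℕ b + 2 * val (x ++ y)                ≡⟨ cong (λ z → bitℕ b + 2 * z) (val-++ x y) ⟩
  bitℕ b + 2 * (val x + 2 ^ p * val y)     ≡⟨ cong (λ v → bitℕ b + v) (*-distribˡ-+ 2 (val x) _) ⟩
  bitℕ b + (2 * val x + 2 * (2 ^ p * val y)) ≡⟨ +-assoc (bitℕ b) _ _ ⟨
  bitℕ b + 2 * val x + 2 * (2 ^ p * val y) ≡⟨ cong (λ v → bitℕ b + 2 * val x + v) (*-assoc 2 (2 ^ p) (val y)) ⟨
  bitℕ b + 2 * val x + 2 * 2 ^ p * val y   ∎
  where open ≡-Reasoning

val-++-block : ∀ {p q} (y : Vec Bool p) (z : Vec Bool q) →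
  2 ^ p * val z ≤ val (y ++ z) × val (y ++ z) < 2 ^ p * suc (val z)
val-++-block {p} y z rewrite val-++ y z =
    m≤n+m (2 ^ p * val z) (val y)
  , (begin-strict
      val y + 2 ^ p * val z   <⟨ +-monoˡ-< (2 ^ p * val z) (val<2^ y) ⟩
      2 ^ p + 2 ^ p * val z   ≡⟨ *-suc (2 ^ p) (val z) ⟨
      2 ^ p * suc (val z)     ∎)
  where open ≤-Reasoning

val-set-bit : ∀ {i n} (w : Vec Bool i) (u : Vec Bool n) →
  val (w ++ true ∷ u) ≡ 2 ^ i + val (w ++ false ∷ u)
val-set-bit []      u = refl
val-set-bit {suc i} (c ∷ w) u = begin
  bitℕ c + 2 * val (w ++ true ∷ u)                 ≡⟨ cong (λ v → bitℕ c + 2 * v) (val-set-bit w u) ⟩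
  bitℕ c + 2 * (2 ^ i + val (w ++ false ∷ u))      ≡⟨ regroup (bitℕ c) (2 ^ i) (val (w ++ false ∷ u)) ⟩
  2 * 2 ^ i + (bitℕ c + 2 * val (w ++ false ∷ u))  ∎
  where
  open ≡-Reasoning
  open ℕ-Solver.+-*-Solver
  regroup : ∀ c p v → c + 2 * (p + v) ≡ 2 * p + (c + 2 * v)
  regroup = solve 3 (λ c p v → c :+ con 2 :* (p :+ v) := con 2 :* p :+ (c :+ con 2 :* v)) refl

bit-at-insert : ∀ {i n q} b (w : Vec Bool i) (u : Vec Bool n) (z : Vec Bool q) →
  bit ((w ++ b ∷ u) ++ z) (suc i) ≡ b
bit-at-insert b []      u z = refl
bit-at-insert b (c ∷ w) u z = bit-at-insert b w u z

infix 4 _≤ᵛ_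
_≤ᵛ_ : ∀ {m} → Vec Bool m → Vec Bool m → Set
_≤ᵛ_ = Pointwise Bool._≤_

bitℕ-mono : ∀ {b b′} → b Bool.≤ b′ → bitℕ b ≤ bitℕ b′
bitℕ-mono f≤t = z≤n
bitℕ-mono b≤b = ≤-refl

val-mono : ∀ {m} {x y : Vec Bool m} → x ≤ᵛ y → val x ≤ val y
val-mono []            = z≤n
val-mono (b≤b′ ∷ x≤y) = +-mono-≤ (bitℕ-mono b≤b′) (*-monoʳ-≤ 2 (val-mono x≤y))

insert-mono : ∀ {i n q} (w : Vec Bool i) (u : Vec Bool n) (z : Vec Bool q) →
  (w ++ false ∷ u) ++ z ≤ᵛ (w ++ true ∷ u) ++ z
insert-mono w u z = Pointwise.++⁺ (Pointwise.++⁺ (≤ᵛ-refl w) (f≤t ∷ ≤ᵛ-refl u)) (≤ᵛ-refl z)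
  where
  ≤ᵛ-refl : ∀ {m} (x : Vec Bool m) → x ≤ᵛ x
  ≤ᵛ-refl x = Pointwise.refl b≤b

val-φ-∷ : ∀ ℓ d a (u : Vec (Fin (2 ^ ℓ)) d) → val (φ ℓ (suc d) (a ∷ u)) ≡ toℕ a + 2 ^ ℓ * val (φ ℓ d u)
val-φ-∷ ℓ d a u = trans (val-++ (toBits ℓ (toℕ a)) (φ ℓ d u)) (cong (_+ _) (val-toBits ℓ (toℕ<n a)))

val-φ-mono : ∀ ℓ d {u v : Vec (Fin (2 ^ ℓ)) d} → u ⪯ v → val (φ ℓ d u) ≤ val (φ ℓ d v)
val-φ-mono ℓ zero    {[]}    {[]}    _   = z≤n
val-φ-mono ℓ (suc d) {a ∷ u} {b ∷ v} u⪯v = begin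
  val (φ ℓ (suc d) (a ∷ u))          ≡⟨ val-φ-∷ ℓ d a u ⟩
  toℕ a + 2 ^ ℓ * val (φ ℓ d u)      ≤⟨ +-mono-≤ (u⪯v zero) (*-monoʳ-≤ (2 ^ ℓ) tail≤) ⟩
  toℕ b + 2 ^ ℓ * val (φ ℓ d v)      ≡⟨ val-φ-∷ ℓ d b v ⟨
  val (φ ℓ (suc d) (b ∷ v))          ∎
  where
  open ≤-Reasoning
  tail≤ : val (φ ℓ d u) ≤ val (φ ℓ d v)
  tail≤ = val-φ-mono ℓ d {u} {v} (λ i → u⪯v (suc i))

φ-reflects-≤ : ∀ ℓ d {u v : Vec (Fin (2 ^ ℓ)) d} → φ ℓ d u ≤ᵛ φ ℓ d v → u ⪯ v
φ-reflects-≤ ℓ (suc d) {a ∷ u} {b ∷ v} le zero =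
  subst₂ _≤_ (val-toBits ℓ (toℕ<n a)) (val-toBits ℓ (toℕ<n b))
    (val-mono (Pointwise.++ˡ⁻ (toBits ℓ (toℕ a)) (toBits ℓ (toℕ b)) le))
φ-reflects-≤ ℓ (suc d) {a ∷ u} {b ∷ v} le (suc i) =
  φ-reflects-≤ ℓ d {u} {v} (Pointwise.++ʳ⁻ (toBits ℓ (toℕ a)) (toBits ℓ (toℕ b)) le) i

fromBits : ∀ {ℓ} → Vec Bool ℓ → Fin (2 ^ ℓ)
fromBits x = fromℕ< (val<2^ x)

φ⁻¹ : ∀ ℓ d → Vec Bool (d * ℓ) → Vec (Fin (2 ^ ℓ)) d
φ⁻¹ ℓ d x = map fromBits (proj₁ (group d ℓ x))

φ∘φ⁻¹ : ∀ ℓ d (x : Vec Bool (d * ℓ)) → φ ℓ d (φ⁻¹ ℓ d x) ≡ x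
φ∘φ⁻¹ ℓ d x with group d ℓ x
... | blocks , x≡concat = begin
  concat (map (λ a → toBits ℓ (toℕ a)) (map fromBits blocks)) ≡⟨ cong concat (map-∘ _ fromBits blocks) ⟨
  concat (map (λ y → toBits ℓ (toℕ (fromBits y))) blocks)    ≡⟨ cong concat (map-cong toBits-fromBits blocks) ⟩
  concat (map (λ y → y) blocks)                              ≡⟨ cong concat (map-id blocks) ⟩
  concat blocks                                              ≡⟨ x≡concat ⟨
  x                                                          ∎
  where
  open ≡-Reasoning
  toBits-fromBits : ∀ (y : Vec Bool ℓ) → toBits ℓ (toℕ (fromBits y)) ≡ y
  toBits-fromBits y = trans (cong (toBits ℓ) (toℕ-fromℕ< (val<2^ y))) (toBits-val y)

lift-twoVal-monotone : ∀ ℓ d → Monotone (lift ℓ d twoVal)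
lift-twoVal-monotone ℓ d u v u⪯v = +≤+ (*-monoʳ-≤ 2 (val-φ-mono ℓ d {u} {v} u⪯v))

injection-≤-length-filter : ∀ {A : Set} {P : A → Set} (P? : Decidable P) (xs : List A) {N} (f : Fin N → A) →
  Injective _≡_ _≡_ f → (∀ t → f t ∈ xs) → (∀ t → P (f t)) → N ≤ length (filter P? xs)
injection-≤-length-filter P? xs {N} f f-injective f∈xs Pf = ≮⇒≥ λ short →
  let t , t′ , t<t′ , same-position = pigeonhole short position
  in <⇒≢ᶠ t<t′ (f-injective (begin
       f t                           ≡⟨ lookup-index (f∈filter t) ⟩
       List.lookup (filter P? xs) (position t)    ≡⟨ cong (List.lookup (filter P? xs)) same-position ⟩
       List.lookup (filter P? xs) (position t′)   ≡⟨ lookup-index (f∈filter t′) ⟨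
       f t′                          ∎))
  where
  open ≡-Reasoning
  f∈filter : ∀ t → f t ∈ filter P? xs
  f∈filter t = ∈-filter⁺ P? (f∈xs t) (Pf t)
  position : Fin N → Fin (length (filter P? xs))
  position t = Any.index (f∈filter t)

∈-points : ∀ n d (u : Vec (Fin n) d) → u ∈ points n d
∈-points n zero    []      = here refl
∈-points n (suc d) (a ∷ u) =
  ∈-concatMap⁺ (λ i → List.map (i ∷_) (points n d)) (lose (∈-allFin a) (∈-map⁺ (a ∷_) (∈-points n d u)))

record ViolatedMatching {A : Set} (_≼_ : A → A → Set) (h : A → ℤ.ℤ) (N : ℕ) : Set where
  field
    endpoint : Bool → Fin N → A
    ordered  : ∀ t → endpoint false t ≼ endpoint true t
    violated : ∀ t → h (endpoint true t) ℤ.< h (endpoint false t)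
    disjoint : ∀ {b b′ t t′} → endpoint b t ≡ endpoint b′ t′ → t ≡ t′

module _ {n d} {h : Vec (Fin n) d → ℤ.ℤ} {N} (M : ViolatedMatching _⪯_ h N) where
  open ViolatedMatching M

  -- A monotone h′ cannot agree with h at both ends of a violated pair, and choosing one point
  -- of disagreement per pair is injective by disjointness.
  matching-≤-distance : ∀ h′ → Monotone h′ → N ≤ distance h h′
  matching-≤-distance h′ h′-mono =
    injection-≤-length-filter (λ u → ¬? (h u ℤP.≟ h′ u)) (points n d) changed
      (λ eq → disjoint eq) (λ t → ∈-points n d (changed t)) h≢h′
    where
    lowerKept : Fin N → Bool
    lowerKept t = does (h (endpoint false t) ℤP.≟ h′ (endpoint false t))
    changed : Fin N → Vec (Fin n) d
    changed t = endpoint (lowerKept t) t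
    h≢h′ : ∀ t → ¬ h (changed t) ≡ h′ (changed t)
    h≢h′ t with h (endpoint false t) ℤP.≟ h′ (endpoint false t)
    ... | no  lower≢ = lower≢
    ... | yes lower≡ = λ upper≡ → ℤP.<-irrefl refl (begin-strict
          h (endpoint true t)    <⟨ violated t ⟩
          h (endpoint false t)   ≡⟨ lower≡ ⟩
          h′ (endpoint false t)  ≤⟨ h′-mono _ _ (ordered t) ⟩
          h′ (endpoint true t)   ≡⟨ upper≡ ⟨
          h (endpoint true t)    ∎)
      where open ℤP.≤-Reasoning

map-matching : ∀ {A B : Set} {_≼_ : A → A → Set} {_⊑_ : B → B → Set} {h : A → ℤ.ℤ} {h′ : B → ℤ.ℤ} {N}
  (f : A → B) → (∀ {x y} → x ≼ y → f x ⊑ f y) → Injective _≡_ _≡_ f → (∀ x → h′ (f x) ≡ h x) →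
  ViolatedMatching _≼_ h N → ViolatedMatching _⊑_ h′ N
map-matching f f-mono f-injective h′∘f≡h M = record
  { endpoint = λ b t → f (endpoint b t)
  ; ordered  = λ t → f-mono (ordered t)
  ; violated = λ t → subst₂ ℤ._<_ (sym (h′∘f≡h _)) (sym (h′∘f≡h _)) (violated t)
  ; disjoint = λ eq → disjoint (f-injective eq)
  }
  where open ViolatedMatching M

lift-matching : ∀ ℓ d {f : Vec Bool (d * ℓ) → ℤ.ℤ} {N} →
  ViolatedMatching _≤ᵛ_ f N → ViolatedMatching _⪯_ (lift ℓ d f) N
lift-matching ℓ d {f} = map-matching (φ⁻¹ ℓ d) φ⁻¹-mono φ⁻¹-injective (λ x → cong f (φ∘φ⁻¹ ℓ d x))
  where
  φ⁻¹-mono : ∀ {x y} → x ≤ᵛ y → φ⁻¹ ℓ d x ⪯ φ⁻¹ ℓ d y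
  φ⁻¹-mono {x} {y} x≤y =
    φ-reflects-≤ ℓ d {φ⁻¹ ℓ d x} {φ⁻¹ ℓ d y}
      (subst₂ _≤ᵛ_ (sym (φ∘φ⁻¹ ℓ d x)) (sym (φ∘φ⁻¹ ℓ d y)) x≤y)
  φ⁻¹-injective : Injective _≡_ _≡_ (φ⁻¹ ℓ d)
  φ⁻¹-injective {x} {y} eq = trans (sym (φ∘φ⁻¹ ℓ d x)) (trans (cong (φ ℓ d) eq) (φ∘φ⁻¹ ℓ d y))

-- ofℕ normalises by a gcd that does not compute on variables, so its arithmetic is done in ℚᵘ.
toℚᵘ-/ : ∀ a n .{{_ : NonZero n}} → toℚᵘ ((+ a) ℚ./ n) ℚᵘ.≃ mkℚᵘ (+ a) (pred n)
toℚᵘ-/ a (suc n) = ℚP.toℚᵘ-fromℚᵘ (mkℚᵘ (+ a) n)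

ofℕ-homo-+ : ∀ a b → ofℕ (a + b) ≡ ofℕ a ℚ.+ ofℕ b
ofℕ-homo-+ a b = ℚP.toℚᵘ-injective (begin
  toℚᵘ (ofℕ (a + b))                ≈⟨ toℚᵘ-/ (a + b) 1 ⟩
  mkℚᵘ (+ (a + b)) 0                ≈⟨ *≡* (cong (ℤ._* + 1) (trans (ℤP.pos-+ a b)
                                         (sym (cong₂ ℤ._+_ (ℤP.*-identityʳ (+ a)) (ℤP.*-identityʳ (+ b)))))) ⟩
  mkℚᵘ (+ a) 0 ℚᵘ.+ mkℚᵘ (+ b) 0    ≈⟨ ℚᵘP.+-cong (toℚᵘ-/ a 1) (toℚᵘ-/ b 1) ⟨
  toℚᵘ (ofℕ a) ℚᵘ.+ toℚᵘ (ofℕ b)    ≈⟨ ℚP.toℚᵘ-homo-+ (ofℕ a) (ofℕ b) ⟨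
  toℚᵘ (ofℕ a ℚ.+ ofℕ b)            ∎)
  where open ℚᵘP.≃-Reasoning

ofℕ-homo-* : ∀ a b → ofℕ (a * b) ≡ ofℕ a ℚ.* ofℕ b
ofℕ-homo-* a b = ℚP.toℚᵘ-injective (begin
  toℚᵘ (ofℕ (a * b))                ≈⟨ toℚᵘ-/ (a * b) 1 ⟩
  mkℚᵘ (+ (a * b)) 0                ≈⟨ *≡* (cong (ℤ._* + 1) (ℤP.pos-* a b)) ⟩
  mkℚᵘ (+ a) 0 ℚᵘ.* mkℚᵘ (+ b) 0    ≈⟨ ℚᵘP.*-cong (toℚᵘ-/ a 1) (toℚᵘ-/ b 1) ⟨
  toℚᵘ (ofℕ a) ℚᵘ.* toℚᵘ (ofℕ b)    ≈⟨ ℚP.toℚᵘ-homo-* (ofℕ a) (ofℕ b) ⟨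
  toℚᵘ (ofℕ a ℚ.* ofℕ b)            ∎)
  where open ℚᵘP.≃-Reasoning

ofℕ-mono-≤ : ∀ {a b} → a ≤ b → ofℕ a ℚ.≤ ofℕ b
ofℕ-mono-≤ {a} {b} a≤b = ℚP.toℚᵘ-cancel-≤ (begin
  toℚᵘ (ofℕ a)    ≃⟨ toℚᵘ-/ a 1 ⟩
  mkℚᵘ (+ a) 0    ≤⟨ *≤* (ℤP.*-monoʳ-≤-nonNeg (+ 1) (+≤+ a≤b)) ⟩
  mkℚᵘ (+ b) 0    ≃⟨ toℚᵘ-/ b 1 ⟨
  toℚᵘ (ofℕ b)    ∎)
  where open ℚᵘP.≤-Reasoning

1/n*n≡1 : ∀ n .{{_ : NonZero n}} → (+ 1) ℚ./ n ℚ.* ofℕ n ≡ 1ℚ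
1/n*n≡1 n@(suc n-1) = ℚP.toℚᵘ-injective (begin
  toℚᵘ ((+ 1) ℚ./ n ℚ.* ofℕ n)                ≈⟨ ℚP.toℚᵘ-homo-* ((+ 1) ℚ./ n) (ofℕ n) ⟩
  toℚᵘ ((+ 1) ℚ./ n) ℚᵘ.* toℚᵘ (ofℕ n)        ≈⟨ ℚᵘP.*-cong (toℚᵘ-/ 1 n) (toℚᵘ-/ n 1) ⟩
  mkℚᵘ (+ 1) n-1 ℚᵘ.* mkℚᵘ (+ n) 0            ≈⟨ *≡* (ℤP.*-assoc (+ 1) (+ n) (+ 1)) ⟩
  ℚᵘ.1ℚᵘ                                      ∎)
  where open ℚᵘP.≃-Reasoning

ofℕ[1+a]-1≡ofℕ[a] : ∀ a → ofℕ (suc a) ℚ.- 1ℚ ≡ ofℕ a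
ofℕ[1+a]-1≡ofℕ[a] a = begin
  ofℕ (1 + a) ℚ.- 1ℚ          ≡⟨ cong (ℚ._- 1ℚ) (ofℕ-homo-+ 1 a) ⟩
  1ℚ ℚ.+ ofℕ a ℚ.- 1ℚ         ≡⟨ solve 1 (λ A → con 1ℚ :+ A :- con 1ℚ := A) refl (ofℕ a) ⟩
  ofℕ a                       ∎
  where
  open ≡-Reasoning
  open +-*-Solver

ofℕ-<⇒≤-1 : ∀ {a b} → a < b → ofℕ a ℚ.≤ ofℕ b ℚ.- 1ℚ
ofℕ-<⇒≤-1 {a} a<b = subst (ℚ._≤ _) (ofℕ[1+a]-1≡ofℕ[a] a) (ℚP.+-monoˡ-≤ (ℚ.- 1ℚ) (ofℕ-mono-≤ a<b))

eps-scale : ∀ r {P N} → P ≡ 2 ^ r * N → eps r ℚ.* ofℕ P ≡ ofℕ N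
eps-scale r {N = N} refl = begin
  eps r ℚ.* ofℕ (2 ^ r * N)                 ≡⟨ cong (eps r ℚ.*_) (ofℕ-homo-* (2 ^ r) N) ⟩
  eps r ℚ.* (ofℕ (2 ^ r) ℚ.* ofℕ N)         ≡⟨ ℚP.*-assoc (eps r) _ _ ⟨
  eps r ℚ.* ofℕ (2 ^ r) ℚ.* ofℕ N           ≡⟨ cong (ℚ._* ofℕ N) (1/n*n≡1 (2 ^ r) {{m^n≢0 2 r}}) ⟩
  1ℚ ℚ.* ofℕ N                              ≡⟨ ℚP.*-identityˡ (ofℕ N) ⟩
  ofℕ N                                     ∎
  where open ≡-Reasoning

block⇒inS : ∀ r {m N k} (x : Vec Bool m) → 2 ^ m ≡ 2 ^ r * N →
  k * (2 * N) ≤ val x → val x < suc k * (2 * N) → inS (eps r) (suc k) x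
block⇒inS r {m} {N} {k} x 2^m≡ lower upper =
    subst (ℚ._≤ ofℕ (val x)) (sym lowerEnd) (ofℕ-mono-≤ lower)
  , subst (λ q → ofℕ (val x) ℚ.≤ q ℚ.- 1ℚ) (sym upperEnd) (ofℕ-<⇒≤-1 upper)
  where
  scaled : ∀ K → ofℕ 2 ℚ.* K ℚ.* eps r ℚ.* ofℕ (2 ^ m) ≡ K ℚ.* ofℕ (2 * N)
  scaled K = begin
    ofℕ 2 ℚ.* K ℚ.* eps r ℚ.* ofℕ (2 ^ m)      ≡⟨ regroup (ofℕ 2) K (eps r) (ofℕ (2 ^ m)) ⟩
    K ℚ.* (ofℕ 2 ℚ.* (eps r ℚ.* ofℕ (2 ^ m)))  ≡⟨ cong (λ q → K ℚ.* (ofℕ 2 ℚ.* q)) (eps-scale r 2^m≡) ⟩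
    K ℚ.* (ofℕ 2 ℚ.* ofℕ N)                    ≡⟨ cong (K ℚ.*_) (ofℕ-homo-* 2 N) ⟨
    K ℚ.* ofℕ (2 * N)                          ∎
    where
    open ≡-Reasoning
    open +-*-Solver
    regroup : ∀ T K E X → T ℚ.* K ℚ.* E ℚ.* X ≡ K ℚ.* (T ℚ.* (E ℚ.* X))
    regroup = solve 4 (λ T K E X → T :* K :* E :* X := K :* (T :* (E :* X))) refl

  lowerEnd : ofℕ 2 ℚ.* (ofℕ (suc k) ℚ.- ofℕ 1) ℚ.* eps r ℚ.* ofℕ (2 ^ m) ≡ ofℕ (k * (2 * N))
  lowerEnd = begin
    ofℕ 2 ℚ.* (ofℕ (suc k) ℚ.- ofℕ 1) ℚ.* eps r ℚ.* ofℕ (2 ^ m)  ≡⟨ scaled (ofℕ (suc k) ℚ.- ofℕ 1) ⟩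
    (ofℕ (suc k) ℚ.- ofℕ 1) ℚ.* ofℕ (2 * N)                      ≡⟨ cong (ℚ._* ofℕ (2 * N)) (ofℕ[1+a]-1≡ofℕ[a] k) ⟩
    ofℕ k ℚ.* ofℕ (2 * N)                                        ≡⟨ ofℕ-homo-* k (2 * N) ⟨
    ofℕ (k * (2 * N))                                            ∎
    where open ≡-Reasoning
  upperEnd : ofℕ 2 ℚ.* ofℕ (suc k) ℚ.* eps r ℚ.* ofℕ (2 ^ m) ≡ ofℕ (suc k * (2 * N))
  upperEnd = trans (scaled (ofℕ (suc k))) (sym (ofℕ-homo-* (suc k) (2 * N)))

half-eps-bound : ∀ r {P N D} → P ≡ 2 ^ r * N → N ≤ D → eps r ℚ.* ((+ 1) ℚ./ 2) ℚ.* ofℕ P ℚ.≤ ofℕ D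
half-eps-bound r {P} {N} {D} P≡ N≤D = begin
  eps r ℚ.* ½ ℚ.* ofℕ P       ≡⟨ solve 3 (λ E H X → E :* H :* X := H :* (E :* X)) refl (eps r) ½ (ofℕ P) ⟩
  ½ ℚ.* (eps r ℚ.* ofℕ P)     ≡⟨ cong (½ ℚ.*_) (eps-scale r P≡) ⟩
  ½ ℚ.* ofℕ N                 ≤⟨ ℚP.*-monoʳ-≤-nonNeg (ofℕ N) {{ℚP.normalize-nonNeg N 1}} ½≤1 ⟩
  1ℚ ℚ.* ofℕ N                ≡⟨ ℚP.*-identityˡ (ofℕ N) ⟩
  ofℕ N                       ≤⟨ ofℕ-mono-≤ N≤D ⟩
  ofℕ D                       ∎
  where
  open ℚP.≤-Reasoning
  open +-*-Solver
  ½ : ℚ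
  ½ = (+ 1) ℚ./ 2
  ½≤1 : ½ ℚ.≤ 1ℚ
  ½≤1 = ℚ.*≤* (+≤+ (s≤s z≤n))

2[c+v]-2c-1<2v : ∀ c v → + (2 * (c + v)) ℤ.- + (2 * c) ℤ.- + 1 ℤ.< + (2 * v)
2[c+v]-2c-1<2v c v = ℤP.i≤pred[j]⇒i<j (ℤP.≤-reflexive (begin
  + (2 * (c + v)) ℤ.- + (2 * c) ℤ.- + 1          ≡⟨ cong (λ n → + n ℤ.- + (2 * c) ℤ.- + 1) (*-distribˡ-+ 2 c v) ⟩
  + (2 * c + 2 * v) ℤ.- + (2 * c) ℤ.- + 1        ≡⟨ cong (λ z → z ℤ.- + (2 * c) ℤ.- + 1) (ℤP.pos-+ (2 * c) (2 * v)) ⟩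
  + (2 * c) ℤ.+ + (2 * v) ℤ.- + (2 * c) ℤ.- + 1  ≡⟨ cancel (+ (2 * c)) (+ (2 * v)) ⟩
  ℤ.pred (+ (2 * v))                             ∎))
  where
  open ≡-Reasoning
  open ℤ-Solver.+-*-Solver
  cancel : ∀ C V → C ℤ.+ V ℤ.- C ℤ.- + 1 ≡ ℤ.pred V
  cancel = solve 2 (λ C V → C :+ V :- C :- con (+ 1) := con (ℤ.- + 1) :+ V) refl

g-unchanged : ∀ {m} ε j k (x : Vec Bool m) → bit x j ≡ false → g ε j k x ≡ twoVal x
g-unchanged ε j k x bit≡false rewrite bit≡false = refl

g-lowered : ∀ {m} ε j k (x : Vec Bool m) → bit x j ≡ true → inS ε k x →
  g ε j k x ≡ twoVal x ℤ.- + (2 ^ j) ℤ.- + 1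
g-lowered ε j k x bit≡true x∈S rewrite bit≡true with inS? ε k x
... | yes _   = refl
... | no  x∉S = contradiction x∈S x∉S

cube-size : ∀ i e r → 2 ^ (i + suc e + r) ≡ 2 ^ suc r * 2 ^ (i + e)
cube-size i e r = begin
  2 ^ (i + suc e + r)               ≡⟨ ^-distribˡ-+-* 2 (i + suc e) r ⟩
  2 ^ (i + suc e) * 2 ^ r           ≡⟨ cong (λ n → 2 ^ n * 2 ^ r) (+-suc i e) ⟩
  2 * 2 ^ (i + e) * 2 ^ r           ≡⟨ solve 2 (λ N R → con 2 :* N :* R := con 2 :* R :* N) refl (2 ^ (i + e)) (2 ^ r) ⟩
  2 * 2 ^ r * 2 ^ (i + e)           ∎
  where
  open ≡-Reasoning
  open ℕ-Solver.+-*-Solver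

-- The t-th pair is a word with bit i + 1 clear resp. set, whose remaining low i + e bits spell t
-- and whose top r bits spell k; both ends lie in S_{k+1}.
g-violated-matching : ∀ i e r k → k < 2 ^ r →
  ViolatedMatching (_≤ᵛ_ {i + suc e + r}) (g (eps (suc r)) (suc i) (suc k)) (2 ^ (i + e))
g-violated-matching i e r k k<2^r = record
  { endpoint = endpoint
  ; ordered  = λ t → insert-mono (low t) (high t) top
  ; violated = violated
  ; disjoint = disjoint
  }
  where
  ε = eps (suc r)
  N = 2 ^ (i + e)

  digits : Fin N → Vec Bool (i + e)
  digits t = toBits (i + e) (toℕ t)
  low : Fin N → Vec Bool i
  low t = take i (digits t)
  high : Fin N → Vec Bool e
  high t = drop i (digits t)
  top : Vec Bool r
  top = toBits r k

  endpoint : Bool → Fin N → Vec Bool (i + suc e + r)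
  endpoint b t = (low t ++ b ∷ high t) ++ top

  disjoint : ∀ {b b′ t t′} → endpoint b t ≡ endpoint b′ t′ → t ≡ t′
  disjoint {b} {b′} {t} {t′} eq = toBits-injective t t′ (begin
    digits t                ≡⟨ take++drop≡id i (digits t) ⟨
    low t ++ high t         ≡⟨ cong₂ _++_ (++-injectiveˡ (low t) (low t′) block≡) high≡ ⟩
    low t′ ++ high t′       ≡⟨ take++drop≡id i (digits t′) ⟩
    digits t′               ∎)
    where
    open ≡-Reasoning
    block≡ : low t ++ b ∷ high t ≡ low t′ ++ b′ ∷ high t′
    block≡ = ++-injectiveˡ (low t ++ b ∷ high t) (low t′ ++ b′ ∷ high t′) eq
    high≡ : high t ≡ high t′
    high≡ = ∷-injectiveʳ (++-injectiveʳ (low t) (low t′) block≡)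

  val-upper : ∀ t → val (endpoint true t) ≡ 2 ^ i + val (endpoint false t)
  val-upper t = begin
    val ((w ++ true ∷ high t) ++ top)                 ≡⟨ val-++ (w ++ true ∷ high t) top ⟩
    val (w ++ true ∷ high t) + T                      ≡⟨ cong (_+ T) (val-set-bit w (high t)) ⟩
    2 ^ i + val (w ++ false ∷ high t) + T             ≡⟨ +-assoc (2 ^ i) _ T ⟩
    2 ^ i + (val (w ++ false ∷ high t) + T)           ≡⟨ cong (λ v → 2 ^ i + v) (val-++ (w ++ false ∷ high t) top) ⟨
    2 ^ i + val ((w ++ false ∷ high t) ++ top)        ∎
    where
    open ≡-Reasoning
    w = low t
    T = 2 ^ (i + suc e) * val top

  upper∈S : ∀ t → inS ε (suc k) (endpoint true t)
  upper∈S t = block⇒inS (suc r) {i + suc e + r} {N} {k} (endpoint true t) (cube-size i e r)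
    (subst (_≤ val (endpoint true t)) (scale k top≡k) (proj₁ block))
    (subst (val (endpoint true t) <_) (scale (suc k) (cong suc top≡k)) (proj₂ block))
    where
    block = val-++-block (low t ++ true ∷ high t) top
    top≡k : val top ≡ k
    top≡k = val-toBits r k<2^r
    scale : ∀ {v} c → v ≡ c → 2 ^ (i + suc e) * v ≡ c * (2 * N)
    scale c refl = trans (cong (λ n → 2 ^ n * c) (+-suc i e)) (*-comm (2 * N) c)

  violated : ∀ t → g ε (suc i) (suc k) (endpoint true t) ℤ.< g ε (suc i) (suc k) (endpoint false t)
  violated t = begin-strict
    g ε (suc i) (suc k) (endpoint true t)
      ≡⟨ g-lowered ε (suc i) (suc k) (endpoint true t) (bit-at-insert true (low t) (high t) top) (upper∈S t) ⟩
    + (2 * val (endpoint true t)) ℤ.- + (2 ^ suc i) ℤ.- + 1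
      ≡⟨ cong (λ v → + (2 * v) ℤ.- + (2 ^ suc i) ℤ.- + 1) (val-upper t) ⟩
    + (2 * (2 ^ i + val (endpoint false t))) ℤ.- + (2 * 2 ^ i) ℤ.- + 1
      <⟨ 2[c+v]-2c-1<2v (2 ^ i) (val (endpoint false t)) ⟩
    twoVal (endpoint false t)
      ≡⟨ g-unchanged ε (suc i) (suc k) (endpoint false t) (bit-at-insert false (low t) (high t) top) ⟨
    g ε (suc i) (suc k) (endpoint false t)
      ∎
    where open ℤP.≤-Reasoning

length-split : ∀ {m i r} → r ≤ m → suc i ≤ m ∸ r → m ≡ i + suc (m ∸ r ∸ suc i) + r
length-split {m} {i} {r} r≤m 1+i≤m∸r = sym (begin
  i + suc (m ∸ r ∸ suc i) + r    ≡⟨ cong (_+ r) (+-suc i (m ∸ r ∸ suc i)) ⟩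
  suc i + (m ∸ r ∸ suc i) + r    ≡⟨ cong (_+ r) (m+[n∸m]≡n 1+i≤m∸r) ⟩
  m ∸ r + r                      ≡⟨ m∸n+n≡m r≤m ⟩
  m                              ∎)
  where open ≡-Reasoning

g-far : ∀ ℓ d i e r k → d * ℓ ≡ i + suc e + r → k < 2 ^ r →
  FarFromMonotone (eps (suc r) ℚ.* ((+ 1) ℚ./ 2)) (lift ℓ d (g (eps (suc r)) (suc i) (suc k)))
g-far ℓ d i e r k m≡ k<2^r h′ h′-mono =
  half-eps-bound (suc r) size≡ (matching-≤-distance (lift-matching ℓ d cube-matching) h′ h′-mono)
  where
  cube-matching : ViolatedMatching _≤ᵛ_ (g (eps (suc r)) (suc i) (suc k)) (2 ^ (i + e))
  cube-matching = subst (λ m → ViolatedMatching (_≤ᵛ_ {m}) (g (eps (suc r)) (suc i) (suc k)) (2 ^ (i + e)))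
    (sym m≡) (g-violated-matching i e r k k<2^r)
  size≡ : (2 ^ ℓ) ^ d ≡ 2 ^ suc r * 2 ^ (i + e)
  size≡ = trans (^-*-assoc 2 ℓ d) (trans (cong (2 ^_) (trans (*-comm ℓ d) m≡)) (cube-size i e r))

proposition2 : (ℓ d r : ℕ) → 1 ≤ d → 1 ≤ r → r ≤ d * ℓ →
    Monotone (lift ℓ d twoVal)
    × ((j k : ℕ) → 1 ≤ j → j ≤ d * ℓ + 1 ∸ r → 1 ≤ k → k ≤ 2 ^ (r ∸ 1) →
       FarFromMonotone (eps r ℚ.* ((+ 1) ℚ./ 2)) (lift ℓ d (g (eps r) j k)))
proposition2 ℓ d (suc r) _ _ r<m = lift-twoVal-monotone ℓ d , far
  where
  far : (j k : ℕ) → 1 ≤ j → j ≤ d * ℓ + 1 ∸ suc r → 1 ≤ k → k ≤ 2 ^ r →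
    FarFromMonotone (eps (suc r) ℚ.* ((+ 1) ℚ./ 2)) (lift ℓ d (g (eps (suc r)) j k))
  far (suc i) (suc k) _ j≤m′ _ k<2^r =
    g-far ℓ d i (d * ℓ ∸ r ∸ suc i) r k (length-split (<⇒≤ r<m) j≤m∸r) k<2^r
    where
    j≤m∸r : suc i ≤ d * ℓ ∸ r
    j≤m∸r = subst (suc i ≤_) (cong (_∸ suc r) (+-comm (d * ℓ) 1)) j≤m′
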